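{- Nice, equivalent, and minimal tDCWs and tDBWs need not be isomorphic, and need not be made isomorphic by $\alpha$-mutation. That is, there are two nice tDCWs $\mathcal{D}_1,\mathcal{D}_2$ with $L(\mathcal{D}_1)=L(\mathcal{D}_2)$, each having the minimum number of states among tDCWs recognizing this language, that are not isomorphic and cannot be made isomorphic by $\alpha$-mutations; and likewise there are two such tDBWs (equivalent, nice, each with the minimum number of states among tDBWs for their language) that are not isomorphic and cannot be made isomorphic by $\alpha$-mutations.
   Context: A deterministic transition-based automaton is $\mathcal{D}=\langle\Sigma,Q,q_0,\delta,\alpha\rangle$ with finite alphabet $\Sigma$, finite state set $Q$, initial state $q_0$, transition function $\delta:Q\times\Sigma\to Q$ with transition set $\Delta=\{\langle q,\sigma,\delta(q,\sigma)\rangle\}$, and $\alpha\subseteq\Delta$ ($\alpha$-transitions; the others are $\bar\alpha$-transitions). The unique run on a word is defined as usual. As a tDCW (co-Büchi), a word is accepted iff its run traverses $\alpha$-transitions only finitely often; as a tDBW (Büchi), iff it traverses $\alpha$-transitions infinitely often. Such an automaton is nice if all its states are reachable from $q_0$ and it is normal: whenever there is a path of $\bar\alpha$-transitions from $q$ to $s$, there is also one from $s$ to $q$. Two such automata are isomorphic if there is a bijection $\kappa$ between their state sets mapping $\alpha$-transitions bijectively onto $\alpha$-transitions and $\bar\alpha$-transitions bijectively onto $\bar\alpha$-transitions (i.e., $\langle q,\sigma,q'\rangle$ is an $\alpha$- (resp. $\bar\alpha$-) transition of the first iff $\langle\kappa(q),\sigma,\kappa(q')\rangle$ is an $\alpha$-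 (resp. $\bar\alpha$-) transition of the second). An $\alpha$-mutation changes the membership of transitions in $\alpha$ while keeping the automaton nice and its language unchanged. -}

module Defs where

open import Data.Nat using (ℕ; zero; suc; _≤_)
open import Data.Fin using (Fin)
open import Data.Bool using (Bool; true; false)
open import Data.List using (List; []; _∷_)
open import Data.Product using (Σ; ∃; _×_; _,_)
open import Relation.Binary.PropositionalEquality using (_≡_)
open import Relation.Nullary using (¬_)
open import Function.Bundles using (_⤖_; Bijection)

-- The α-set is given by its characteristic
-- function on (q , σ) (a transition is determined by q and σ).
record Aut (k n : ℕ) : Set where
  field
    init  : Fin n
    δ     : Fin n → Fin k → Fin n
    α     : Fin n → Fin k → Bool
open Aut public

withα : ∀ {k n} → Aut k n → (Fin n → Fin k → Bool) → Aut k n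
withα D α' = record { init = init D ; δ = δ D ; α = α' }

Word : ℕ → Set
Word k = ℕ → Fin k

run : ∀ {k n} → Aut k n → Word k → ℕ → Fin n
run D w zero    = init D
run D w (suc i) = δ D (run D w i) (w i)

αAt : ∀ {k n} → Aut k n → Word k → ℕ → Set
αAt D w i = α D (run D w i) (w i) ≡ true

AccC : ∀ {k n} → Aut k n → Word k → Set
AccC D w = Σ ℕ λ N → ∀ i → N ≤ i → ¬ αAt D w i

AccB : ∀ {k n} → Aut k n → Word k → Set
AccB D w = ∀ N → Σ ℕ λ i → N ≤ i × αAt D w i

Cond : Set₁
Cond = ∀ {k n} → Aut k n → Word k → Set

Equiv : Cond → ∀ {k n m} → Aut k n → Aut k m → Set
Equiv Acc D₁ D₂ = ∀ w → (Acc D₁ w → Acc D₂ w) × (Acc D₂ w → Acc D₁ w)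

δ* : ∀ {k n} → Aut k n → Fin n → List (Fin k) → Fin n
δ* D q []      = q
δ* D q (σ ∷ u) = δ* D (δ D q σ) u

Reachable : ∀ {k n} → Aut k n → Set
Reachable {k} D = ∀ q → Σ (List (Fin k)) λ u → δ* D (init D) u ≡ q

data ᾱPath {k n} (D : Aut k n) : Fin n → Fin n → Set where
  here : ∀ {q} → ᾱPath D q q
  step : ∀ {q s} (σ : Fin k) → α D q σ ≡ false → ᾱPath D (δ D q σ) s → ᾱPath D q s

Normal : ∀ {k n} → Aut k n → Set
Normal D = ∀ q s → ᾱPath D q s → ᾱPath D s q

Nice : ∀ {k n} → Aut k n → Set
Nice D = Reachable D × Normal D

Minimal : Cond → ∀ {k n} → Aut k n → Set
Minimal Acc {k} {n} D = ∀ m (D' : Aut k m) → Equiv Acc D D' → n ≤ m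

αTrans : ∀ {k n} → Aut k n → Fin n → Fin k → Fin n → Set
αTrans D q σ q' = δ D q σ ≡ q' × α D q σ ≡ true

ᾱTrans : ∀ {k n} → Aut k n → Fin n → Fin k → Fin n → Set
ᾱTrans D q σ q' = δ D q σ ≡ q' × α D q σ ≡ false

Isomorphic : ∀ {k n m} → Aut k n → Aut k m → Set
Isomorphic {k} {n} {m} D₁ D₂ =
  Σ (Fin n ⤖ Fin m) λ κ →
    let f = Bijection.to κ in
    ∀ q σ q' →
      ((αTrans D₁ q σ q' → αTrans D₂ (f q) σ (f q'))
        × (αTrans D₂ (f q) σ (f q') → αTrans D₁ q σ q'))
    × ((ᾱTrans D₁ q σ q' → ᾱTrans D₂ (f q) σ (f q'))
        × (ᾱTrans D₂ (f q) σ (f q') → ᾱTrans D₁ q σ q'))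

-- α' is the α-set of an automaton obtained from D by α-mutation(s):
-- only α-membership changes, niceness and the language are preserved
Mutation : Cond → ∀ {k n} → Aut k n → (Fin n → Fin k → Bool) → Set
Mutation Acc D α' = Nice (withα D α') × Equiv Acc D (withα D α')

Counterexample : Cond → Set
Counterexample Acc =
  Σ ℕ λ k → Σ ℕ λ n → Σ ℕ λ m → Σ (Aut k n) λ D₁ → Σ (Aut k m) λ D₂ →
    Nice D₁ × Nice D₂ × Equiv Acc D₁ D₂
    × Minimal Acc D₁ × Minimal Acc D₂
    × ¬ Isomorphic D₁ D₂
    × ¬ (Σ (Fin n → Fin k → Bool) λ α₁ → Σ (Fin m → Fin k → Bool) λ α₂ →
           Mutation Acc D₁ α₁ × Mutation Acc D₂ α₂
           × Isomorphic (withα D₁ α₁) (withα D₂ α₂))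

-- Over {a, b}, let α mark exactly a b read right after a b. The automaton lastLetter remembers
-- the last letter, so it marks every factor bb; pairing forgets a b once it has been paired, so it
-- marks every second b of each block. Every factor bb is thus marked by pairing at the same
-- position or one step earlier, hence the two automata recognize the same language both as
-- co-Büchi automata (finitely many bb) and as Büchi automata (infinitely many bb). A one-state
-- automaton cannot separate b^ω from (ab)^ω, so two states are minimal. An isomorphism commutes with
-- δ whatever α is, and in pairing the a-successor of a equals the b-successor of b, whereas in
-- lastLetter a-successors and b-successors never meet.
module Submission where

open import Defs
open import Data.Product using (_×_; Σ; _,_; proj₁; proj₂)
open import Data.Sum using (_⊎_; inj₁; inj₂)
open import Data.Nat using (ℕ; zero; suc; _≤_; z≤n; s≤s; pred)
open import Data.Nat.Properties using (≤-refl; ≤-trans; n≤1+n; pred-mono-≤)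
open import Data.Fin using (Fin; zero; suc)
open import Data.Bool using (Bool; true; false)
open import Data.Empty using (⊥-elim)
open import Data.List using ([]; _∷_)
open import Relation.Binary.PropositionalEquality using (_≡_; refl; sym; trans; subst)
open import Relation.Nullary using (¬_)
open import Function.Bundles using (Bijection)

FinitelyOften : (ℕ → Set) → Set
FinitelyOften P = Σ ℕ λ N → ∀ i → N ≤ i → ¬ P i

InfinitelyOften : (ℕ → Set) → Set
InfinitelyOften P = ∀ N → Σ ℕ λ i → N ≤ i × P i

module _ {P : ℕ → Set} where

  infinitelyOften⇒¬finitelyOften : InfinitelyOften P → ¬ FinitelyOften P
  infinitelyOften⇒¬finitelyOften io (N , never) with io N
  ... | i , N≤i , p = never i N≤i p

  finitelyOften-anti : ∀ {Q} → (∀ i → P i → Q i) → FinitelyOften Q → FinitelyOften P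
  finitelyOften-anti P⇒Q (N , never) = N , λ i N≤i p → never i N≤i (P⇒Q i p)

  infinitelyOften-mono : ∀ {Q} → (∀ i → P i → Q i) → InfinitelyOften P → InfinitelyOften Q
  infinitelyOften-mono P⇒Q io N with io N
  ... | i , N≤i , p = i , N≤i , P⇒Q i p

  finitelyOften-lag : ∀ {Q} → (∀ i → Q i → P i ⊎ P (pred i)) → FinitelyOften P → FinitelyOften Q
  finitelyOften-lag Q⇒P (N , never) = suc N , λ i 1+N≤i q → absurd i 1+N≤i (Q⇒P i q)
    where
    absurd : ∀ i → suc N ≤ i → ¬ (P i ⊎ P (pred i))
    absurd i 1+N≤i (inj₁ p) = never i (≤-trans (n≤1+n N) 1+N≤i) p
    absurd i 1+N≤i (inj₂ p) = never (pred i) (pred-mono-≤ 1+N≤i) p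

  infinitelyOften-lag : ∀ {Q} → (∀ i → Q i → P i ⊎ P (pred i)) → InfinitelyOften Q → InfinitelyOften P
  infinitelyOften-lag Q⇒P io N with io (suc N)
  ... | i , 1+N≤i , q with Q⇒P i q
  ... | inj₁ p = i , ≤-trans (n≤1+n N) 1+N≤i , p
  ... | inj₂ p = pred i , pred-mono-≤ 1+N≤i , p

module _ {Acc : Cond} {k n m} {D₁ : Aut k n} {D₂ : Aut k m} where

  Equiv-sym : Equiv Acc D₁ D₂ → Equiv Acc D₂ D₁
  Equiv-sym eq w = proj₂ (eq w) , proj₁ (eq w)

  Equiv-trans : ∀ {l} {D₃ : Aut k l} → Equiv Acc D₁ D₂ → Equiv Acc D₂ D₃ → Equiv Acc D₁ D₃
  Equiv-trans eq₁₂ eq₂₃ w =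
    (λ acc → proj₁ (eq₂₃ w) (proj₁ (eq₁₂ w) acc)) , (λ acc → proj₂ (eq₁₂ w) (proj₂ (eq₂₃ w) acc))

Minimal-resp-Equiv : ∀ {Acc : Cond} {k n} {D E : Aut k n} →
  Equiv Acc D E → Minimal Acc E → Minimal Acc D
Minimal-resp-Equiv {Acc} D≈E minE m D' D≈D' = minE m D' (Equiv-trans {Acc} (Equiv-sym {Acc} D≈E) D≈D')

minimal-two-states : ∀ {Acc : Cond} {k} {D : Aut k 2} →
  (∀ (D' : Aut k 1) → ¬ Equiv Acc D D') → Minimal Acc D
minimal-two-states no-one-state zero D' _ with init D'
... | ()
minimal-two-states no-one-state (suc zero) D' D≈D' = ⊥-elim (no-one-state D' D≈D')
minimal-two-states no-one-state (suc (suc m)) D' _ = s≤s (s≤s z≤n)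

Isomorphic⇒δ-commute : ∀ {k n m} {D : Aut k n} {E : Aut k m} (iso : Isomorphic D E) →
  let f = Bijection.to (proj₁ iso) in ∀ q σ → δ E (f q) σ ≡ f (δ D q σ)
Isomorphic⇒δ-commute {D = D} (κ , preserves) q σ with α D q σ in αqσ
... | true  = proj₁ (proj₁ (proj₁ (preserves q σ (δ D q σ))) (refl , αqσ))
... | false = proj₁ (proj₁ (proj₂ (preserves q σ (δ D q σ))) (refl , αqσ))

module _ {k} (D : Aut k 1) (w : Word k) (i : ℕ) where

  private
    run≡zero : run D w i ≡ zero
    run≡zero with run D w i
    ... | zero = refl

  αAt-one-state⇒ : αAt D w i → α D zero (w i) ≡ true
  αAt-one-state⇒ = subst (λ q → α D q (w i) ≡ true) run≡zero

  αAt-one-state⇐ : α D zero (w i) ≡ true → αAt D w i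
  αAt-one-state⇐ = subst (λ q → α D q (w i) ≡ true) (sym run≡zero)

pattern a = zero
pattern b = suc zero

bω : Word 2
bω _ = b

flip : Fin 2 → Fin 2
flip a = b
flip b = a

abω : Word 2
abω zero    = a
abω (suc i) = flip (abω i)

abω-b-infinitelyOften : InfinitelyOften (λ i → abω i ≡ b)
abω-b-infinitelyOften N with b-or-flip-b (abω N)
  where
  b-or-flip-b : ∀ σ → σ ≡ b ⊎ flip σ ≡ b
  b-or-flip-b a = inj₂ refl
  b-or-flip-b b = inj₁ refl
... | inj₁ abωN≡b  = N , ≤-refl , abωN≡b
... | inj₂ abω1+N≡b = suc N , n≤1+n N , abω1+N≡b

two-state-nice : (D : Aut 2 2) → init D ≡ a → ᾱTrans D a b b → ᾱTrans D b a a → Nice D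
two-state-nice D init≡a (ab , ᾱab) (ba , ᾱba) = reachable , λ q s _ → path s q
  where
  reachable : Reachable D
  reachable a = [] , init≡a
  reachable b rewrite init≡a = b ∷ [] , ab
  path : ∀ q s → ᾱPath D q s
  path a a = here
  path a b = step b ᾱab (subst (λ q → ᾱPath D q b) (sym ab) here)
  path b a = step a ᾱba (subst (λ q → ᾱPath D q a) (sym ba) here)
  path b b = here

αOnBB : Fin 2 → Fin 2 → Bool
αOnBB b b = true
αOnBB _ _ = false

-- States are named by letters: in lastLetter the state is the last letter read, in pairing the
-- state is b exactly after a b that is not yet paired with its predecessor.
lastLetter : Aut 2 2
lastLetter = record { init = a ; δ = λ _ σ → σ ; α = αOnBB }

pairingδ : Fin 2 → Fin 2 → Fin 2
pairingδ a σ = σ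
pairingδ b _ = a

pairing : Aut 2 2
pairing = record { init = a ; δ = pairingδ ; α = αOnBB }

lastLetter-nice : Nice lastLetter
lastLetter-nice = two-state-nice lastLetter refl (refl , refl) (refl , refl)

pairing-nice : Nice pairing
pairing-nice = two-state-nice pairing refl (refl , refl) (refl , refl)

lastLetter-αAt-bω : InfinitelyOften (αAt lastLetter bω)
lastLetter-αAt-bω N = suc N , n≤1+n N , refl

lastLetter-¬αAt-abω : ∀ i → ¬ αAt lastLetter abω i
lastLetter-¬αAt-abω zero ()
lastLetter-¬αAt-abω (suc i) with abω i
lastLetter-¬αAt-abω (suc i) | a = λ ()
lastLetter-¬αAt-abω (suc i) | b = λ ()

pairing-αAt⇒lastLetter-αAt : ∀ w i → αAt pairing w i → αAt lastLetter w i
pairing-αAt⇒lastLetter-αAt w zero ()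
pairing-αAt⇒lastLetter-αAt w (suc i) = pairing-α (run pairing w i) (w i) (w (suc i))
  where
  pairing-α : ∀ q σ τ → αOnBB (pairingδ q σ) τ ≡ true → αOnBB σ τ ≡ true
  pairing-α a b b _ = refl
  pairing-α a a b ()
  pairing-α b σ b ()

-- A factor bb not marked by pairing was paired off one step earlier.
lastLetter-αAt⇒pairing-αAt : ∀ w i → αAt lastLetter w i → αAt pairing w i ⊎ αAt pairing w (pred i)
lastLetter-αAt⇒pairing-αAt w zero ()
lastLetter-αAt⇒pairing-αAt w (suc i) = bb (run pairing w i) (w i) (w (suc i))
  where
  bb : ∀ q σ τ → αOnBB σ τ ≡ true → αOnBB (pairingδ q σ) τ ≡ true ⊎ αOnBB q σ ≡ true
  bb a b b _ = inj₁ refl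
  bb b b b _ = inj₂ refl

pairing≈lastLetter-coBüchi : Equiv AccC pairing lastLetter
pairing≈lastLetter-coBüchi w =
  finitelyOften-lag (lastLetter-αAt⇒pairing-αAt w) , finitelyOften-anti (pairing-αAt⇒lastLetter-αAt w)

pairing≈lastLetter-Büchi : Equiv AccB pairing lastLetter
pairing≈lastLetter-Büchi w =
  infinitelyOften-mono (pairing-αAt⇒lastLetter-αAt w) , infinitelyOften-lag (lastLetter-αAt⇒pairing-αAt w)

one-state-α-b⇒αAt-abω : (D : Aut 2 1) → α D zero b ≡ true → InfinitelyOften (αAt D abω)
one-state-α-b⇒αAt-abω D αb = infinitelyOften-mono b⇒αAt abω-b-infinitelyOften
  where
  b⇒αAt : ∀ i → abω i ≡ b → αAt D abω i
  b⇒αAt i abωi≡b = αAt-one-state⇐ D abω i (subst (λ σ → α D zero σ ≡ true) (sym abωi≡b) αb)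

lastLetter-coBüchi-no-one-state : ∀ (D : Aut 2 1) → ¬ Equiv AccC lastLetter D
lastLetter-coBüchi-no-one-state D eq with α D zero b in αb
... | true  = infinitelyOften⇒¬finitelyOften (one-state-α-b⇒αAt-abω D αb)
                (proj₁ (eq abω) (zero , λ i _ → lastLetter-¬αAt-abω i))
... | false = infinitelyOften⇒¬finitelyOften lastLetter-αAt-bω
                (proj₂ (eq bω) (zero , λ i _ αAt → ¬αAt i αAt))
  where
  ¬αAt : ∀ i → ¬ αAt D bω i
  ¬αAt i αAt with trans (sym (αAt-one-state⇒ D bω i αAt)) αb
  ... | ()

lastLetter-Büchi-no-one-state : ∀ (D : Aut 2 1) → ¬ Equiv AccB lastLetter D
lastLetter-Büchi-no-one-state D eq with proj₁ (eq bω) lastLetter-αAt-bω zero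
... | i , _ , αAt with proj₂ (eq abω) (one-state-α-b⇒αAt-abω D (αAt-one-state⇒ D bω i αAt)) zero
... | j , _ , αAt-abω = lastLetter-¬αAt-abω j αAt-abω

pairing≇lastLetter : ∀ α₁ α₂ → ¬ Isomorphic (withα pairing α₁) (withα lastLetter α₂)
pairing≇lastLetter α₁ α₂ iso = a≢b (trans (commute a a) (sym (commute b b)))
  where
  f : Fin 2 → Fin 2
  f = Bijection.to (proj₁ iso)
  commute : ∀ q σ → σ ≡ f (pairingδ q σ)
  commute = Isomorphic⇒δ-commute {D = withα pairing α₁} {E = withα lastLetter α₂} iso
  a≢b : ¬ _≡_ {A = Fin 2} a b
  a≢b ()

counterexample : ∀ {Acc : Cond} → Equiv Acc pairing lastLetter →
  (∀ (D : Aut 2 1) → ¬ Equiv Acc lastLetter D) → Counterexample Acc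
counterexample {Acc} pairing≈lastLetter no-one-state =
  2 , 2 , 2 , pairing , lastLetter , pairing-nice , lastLetter-nice , pairing≈lastLetter ,
  Minimal-resp-Equiv {Acc} pairing≈lastLetter lastLetter-minimal , lastLetter-minimal ,
  pairing≇lastLetter αOnBB αOnBB , λ { (α₁ , α₂ , _ , _ , iso) → pairing≇lastLetter α₁ α₂ iso }
  where
  lastLetter-minimal : Minimal Acc lastLetter
  lastLetter-minimal = minimal-two-states {Acc} no-one-state

theorem4p15 : Counterexample AccC × Counterexample AccB
theorem4p15 =
  counterexample {AccC} pairing≈lastLetter-coBüchi lastLetter-coBüchi-no-one-state ,
  counterexample {AccB} pairing≈lastLetter-Büchi lastLetter-Büchi-no-one-state
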